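{- In the game $i\textsc{ -Mark}(\{1\},\{2,3\})$ convergence occurs in at most $64$ steps; that is, for every starting position $n\ge 0$ there is some $c'$ with $1\le c'\le 64$ such that convergence occurs in $c'$ steps starting at $n$.
   Context: For sets $S,D$ of positive integers with $\min D\ge 2$, the impartial game $i\textsc{ -Mark}(S,D)$ has positions $n\in\mathbb N=\{0,1,2,\dots\}$; from $n$ one may move to $n-s$ for any $s\in S$ with $n-s\ge 0$ (a subtraction follower), and to $n/d$ for any $d\in D$ with $n>0$ and $d\mid n$ (a division follower). $\mathcal G$ denotes the Sprague--Grundy function: $\mathcal G(n)=\operatorname{mex}\{\mathcal G(w): w \text{ a follower of } n\}$, where $\operatorname{mex} A=\min(\mathbb N\setminus A)$. Let $\varphi(n)$ be the number of followers of $n$ and $s=\max S$. A guess seed for starting position $n$ is a tuple $\overline\sigma=(\sigma_n,\dots,\sigma_{n+s-1})$ of integers with $0\le\sigma_i\le\varphi(i)$; $\Sigma_n$ is the set of all such seeds. The guess sequence $\mathcal G_{\overline\sigma}$ is defined by $\mathcal G_{\overline\sigma}(i)=\sigma_i$ for $n\le i<n+s$ and, for $m\ge n+s$, $\mathcal G_{\overline\sigma}(m)=\operatorname{mex}\big(\{\mathcal G_{\overline\sigma}(m-t): t\in S\}\cup\{\mathcal G(m/d): d\in D,\ d\mid m\}\big)$. Convergence occurs in $c$ steps starting at position $n$ if $c\ge s$ and $\mathcal G_{\overline\sigma}(m)=\mathcal G_{\overline\sigma'}(m)$ for all $\overline\sigma,\overline\sigma'\in\Sigma_n$ and all $n+c\le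 m<n+c+s$. For a game, convergence occurs in $c$ steps if for every starting position $n$ convergence occurs in at most $c$ steps. -}

module Defs where

open import Data.Nat using (ℕ; zero; suc; _+_; _∸_; _≤_; _<_; _≟_)
open import Data.Nat.DivMod using (_/_)
open import Data.Nat.Divisibility using (_∣?_)
open import Data.List using (List; deduplicate; []; _∷_; _++_; map; length; upTo; filter; concatMap)
open import Data.List.Membership.DecPropositional _≟_ using (_∉?_)
open import Data.Product using (_×_)
open import Relation.Nullary using (yes; no)
open import Relation.Binary.PropositionalEquality using (_≡_)

-- mex A = least natural number not in the (finite) list A.
-- Some element of [0 .. length A] is absent from A, so the default is never used.
mex : List ℕ → ℕ
mex A with filter (_∉? A) (upTo (suc (length A)))
... | []    = length A
... | k ∷ _ = k

S : List ℕ
S = 1 ∷ []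

D : List ℕ
D = 2 ∷ 3 ∷ []

subF : ℕ → ℕ → List ℕ
subF n t with t Data.Nat.≤? n
... | yes _ = (n ∸ t) ∷ []
... | no  _ = []

divF : ℕ → ℕ → List ℕ
divF zero    d = []
divF (suc n) zero = []
divF (suc n) (suc k) with suc k ∣? suc n
... | yes _ = (suc n / suc k) ∷ []
... | no  _ = []

followers : ℕ → List ℕ
followers n = concatMap (subF n) S ++ concatMap (divF n) D

φ : ℕ → ℕ
φ n = length (deduplicate _≟_ (followers n))

-- Sprague–Grundy function, via fuel: all followers of n are < n, so fuel
-- suc n suffices and 𝒢 n = mex { 𝒢 w : w follower of n }.
𝒢f : ℕ → ℕ → ℕ
𝒢f zero    n = 0
𝒢f (suc k) n = mex (map (𝒢f k) (followers n))

𝒢 : ℕ → ℕ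
𝒢 n = 𝒢f (suc n) n

-- Guess sequence for starting position n with seed σ (here s = max S = 1,
-- so a seed is a single value σ_n).  gseq n σ j = 𝒢_σ(n + j).
gseq : ℕ → ℕ → ℕ → ℕ
gseq n σ zero    = σ
gseq n σ (suc j) = mex (gseq n σ j ∷ map 𝒢 (concatMap (divF (n + suc j)) D))

guess : ℕ → ℕ → ℕ → ℕ
guess n σ m = gseq n σ (m ∸ n)

ConvergesIn : ℕ → ℕ → Set
ConvergesIn n c =
  1 ≤ c ×
  (∀ σ σ' → σ ≤ φ n → σ' ≤ φ n →
     ∀ m → n + c ≤ m → m < n + c + 1 → guess n σ m ≡ guess n σ' m)

{-# OPTIONS --safe #-}
-- A guess sequence evolves by x ↦ mex (x ∷ E m), where E m lists the Grundy
-- values of m / 2 and m / 3 when these exist; all Grundy values are at most 3.  Write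
-- n = r + 12 q.  Whether m = t + 12 q has a half or a third depends only on t, and the
-- quotients are then k + 6 q and k + 4 q for the corresponding quotient k of t.  So for
-- each of the 12 residues r the set of values of all seeds can be followed symbolically,
-- branching over the unknown Grundy values of the quotients.  Without further knowledge
-- some branches never collapse; it suffices to know that consecutive halving quotients
-- obey 𝒢 (K + 1) = mex (𝒢 K ∷ E (K + 1)), where the shape of E (K + 1) is that of
-- E (k + 1) because 6 divides 6 q (this fails for the thirds k + 4 q, which are left
-- unconstrained).  Then every branch collapses within 11 steps.
module Submission where

open import Defs
open import Data.Nat using (ℕ; _≤_)
open import Data.Product using (∃; _×_)

open import Data.Bool using (Bool; true; false; T; _∨_)
open import Data.Bool.Properties using (T-∨)
open import Data.Bool.ListAction using (all)
open import Data.List using (List; []; _∷_; [_]; _++_; map; length; upTo; filter; concatMap; cartesianProductWith)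
open import Data.List.Properties using (map-++; map-∘; length-++; length-map; ++-identityʳ; length-deduplicate)
open import Data.List.Membership.Propositional using (_∈_)
open import Data.List.Membership.Propositional.Properties using (∈-map⁺; ∈-upTo⁺; ∈-upTo⁻; ∈-filter⁺; ∈-filter⁻; ∈-cartesianProductWith⁺)
open import Data.List.Relation.Unary.All as All using ()
open import Data.List.Relation.Unary.All.Properties using (all⁺)
open import Data.List.Relation.Unary.Any using (here; there)
open import Data.Maybe using (Maybe; just; nothing)
open import Data.Nat using (zero; suc; _+_; _*_; _∸_; _<_; _≟_; _≤?_; _≡ᵇ_; _/_; _%_; z≤n; s≤s)
open import Data.List.Membership.DecPropositional _≟_ using (_∈?_; _∉?_)
open import Data.Nat.Divisibility using (_∣_; _∣?_; divides; ∣m+n∣m⇒∣n; ∣n⇒∣m*n; n∣m*n)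
open import Data.Nat.DivMod using (m≡m%n+[m/n]*n; m%n<n; m*n/n≡m)
open import Data.Nat.Properties
open import Data.Product using (_,_; proj₁)
open import Data.Sum using (inj₁; inj₂)
open import Data.Unit using (⊤; tt)
open import Function using (Equivalence)
open import Relation.Nullary using (¬_; Dec; yes; no; contradiction)
open import Relation.Nullary.Decidable using (_→-dec_)
open import Relation.Unary using (Decidable)
open import Relation.Binary.PropositionalEquality hiding ([_])

private
  variable
    A B : Set

all-∈ : (p : A → Bool) {xs : List A} {x : A} → T (all p xs) → x ∈ xs → T (p x)
all-∈ p ok x∈ = All.lookup (all⁺ p _ ok) x∈

length-concatMap≤ : (f : A → List B) → (∀ x → length (f x) ≤ 1) →
                    ∀ xs → length (concatMap f xs) ≤ length xs
length-concatMap≤ f f≤1 []       = z≤n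
length-concatMap≤ f f≤1 (x ∷ xs) = begin
  length (f x ++ concatMap f xs)          ≡⟨ length-++ (f x) ⟩
  length (f x) + length (concatMap f xs)  ≤⟨ +-mono-≤ (f≤1 x) (length-concatMap≤ f f≤1 xs) ⟩
  suc (length xs)                         ∎
  where open ≤-Reasoning

mex≤length : ∀ xs → mex xs ≤ length xs
mex≤length xs with filter (_∉? xs) (upTo (suc (length xs))) in eq
... | []    = ≤-refl
... | k ∷ _ = m<1+n⇒m≤n (∈-upTo⁻ (proj₁ (∈-filter⁻ (_∉? xs) (subst (k ∈_) (sym eq) (here refl)))))

length-subF≤1 : ∀ x t → length (subF x t) ≤ 1
length-subF≤1 x t with t ≤? x
... | yes _ = ≤-refl
... | no  _ = z≤n

length-divF≤1 : ∀ x d → length (divF x d) ≤ 1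
length-divF≤1 zero    d       = z≤n
length-divF≤1 (suc x) zero    = z≤n
length-divF≤1 (suc x) (suc d) with suc d ∣? suc x
... | yes _ = ≤-refl
... | no  _ = z≤n

length-followers≤3 : ∀ x → length (followers x) ≤ 3
length-followers≤3 x = begin
  length (followers x)                                          ≡⟨ length-++ (concatMap (subF x) S) ⟩
  length (concatMap (subF x) S) + length (concatMap (divF x) D) ≤⟨ +-mono-≤ subtractions divisions ⟩
  1 + 2                                                         ∎
  where
  open ≤-Reasoning
  subtractions : length (concatMap (subF x) S) ≤ 1
  subtractions = length-concatMap≤ (subF x) (length-subF≤1 x) S
  divisions : length (concatMap (divF x) D) ≤ 2
  divisions = length-concatMap≤ (divF x) (length-divF≤1 x) D

𝒢f≤3 : ∀ fuel x → 𝒢f fuel x ≤ 3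
𝒢f≤3 zero       x = z≤n
𝒢f≤3 (suc fuel) x = begin
  mex (map (𝒢f fuel) (followers x))    ≤⟨ mex≤length (map (𝒢f fuel) (followers x)) ⟩
  length (map (𝒢f fuel) (followers x)) ≡⟨ length-map (𝒢f fuel) (followers x) ⟩
  length (followers x)                 ≤⟨ length-followers≤3 x ⟩
  3                                    ∎
  where open ≤-Reasoning

𝒢≤3 : ∀ x → 𝒢 x ≤ 3
𝒢≤3 x = 𝒢f≤3 (suc x) x

φ≤3 : ∀ n → φ n ≤ 3
φ≤3 n = ≤-trans (length-deduplicate _≟_ (followers n)) (length-followers≤3 n)

divF-∣ : ∀ x d k → suc x ≡ k * suc d → divF (suc x) (suc d) ≡ [ k ]
divF-∣ x d k eq with suc d ∣? suc x
... | yes _ = cong [_] (trans (cong (_/ suc d) eq) (m*n/n≡m k (suc d)))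
... | no ∤ = contradiction (divides k eq) ∤

divF-∤ : ∀ x d → ¬ (d ∣ x) → divF x d ≡ []
divF-∤ zero    d       ∤ = refl
divF-∤ (suc x) zero    ∤ = refl
divF-∤ (suc x) (suc d) ∤ with suc d ∣? suc x
... | yes d∣x = contradiction d∣x ∤
... | no  _ = refl

divF-+-multiple : ∀ x q M d → divF (suc x + q * (M * d)) d ≡ map (_+ q * M) (divF (suc x) d)
divF-+-multiple x q M zero    = refl
divF-+-multiple x q M (suc d) = shift (suc d ∣? suc x)
  where
  open ≡-Reasoning
  shift : Dec (suc d ∣ suc x) → divF (suc x + q * (M * suc d)) (suc d) ≡ map (_+ q * M) (divF (suc x) (suc d))
  shift (yes (divides k eq)) = begin
    divF (suc x + q * (M * suc d)) (suc d) ≡⟨ divF-∣ _ d (k + q * M) shifted ⟩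
    [ k + q * M ]                          ≡⟨ cong (map (_+ q * M)) (divF-∣ x d k eq) ⟨
    map (_+ q * M) (divF (suc x) (suc d))  ∎
    where
    shifted : suc x + q * (M * suc d) ≡ (k + q * M) * suc d
    shifted = begin
      suc x + q * (M * suc d)   ≡⟨ cong₂ _+_ eq (sym (*-assoc q M (suc d))) ⟩
      k * suc d + q * M * suc d ≡⟨ *-distribʳ-+ (suc d) k (q * M) ⟨
      (k + q * M) * suc d       ∎
  shift (no ∤) = begin
    divF (suc x + q * (M * suc d)) (suc d) ≡⟨ divF-∤ _ (suc d) ∤-shifted ⟩
    []                                     ≡⟨ cong (map (_+ q * M)) (divF-∤ (suc x) (suc d) ∤) ⟨
    map (_+ q * M) (divF (suc x) (suc d))  ∎
    where
    ∤-shifted : ¬ (suc d ∣ suc x + q * (M * suc d))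
    ∤-shifted d∣ = ∤ (∣m+n∣m⇒∣n (subst (suc d ∣_) (+-comm (suc x) _) d∣) (∣n⇒∣m*n q (n∣m*n M)))

map-concatMap-divF : ∀ (g : ℕ → ℕ) m → map g (concatMap (divF m) D) ≡ map g (divF m 2) ++ map g (divF m 3)
map-concatMap-divF g m = begin
  map g (divF m 2 ++ divF m 3 ++ [])         ≡⟨ map-++ g (divF m 2) _ ⟩
  map g (divF m 2) ++ map g (divF m 3 ++ []) ≡⟨ cong (λ ys → map g (divF m 2) ++ map g ys) (++-identityʳ _) ⟩
  map g (divF m 2) ++ map g (divF m 3)       ∎
  where open ≡-Reasoning

valueSlots : List ℕ → List (List ℕ)
valueSlots []      = [ [] ]
valueSlots (_ ∷ _) = map [_] (upTo 4)

map∈valueSlots : {g : ℕ → ℕ} → (∀ y → g y ≤ 3) → ∀ xs → length xs ≤ 1 → map g xs ∈ valueSlots xs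
map∈valueSlots g≤3 []          _         = here refl
map∈valueSlots g≤3 (k ∷ [])    _         = ∈-map⁺ [_] (∈-upTo⁺ (s≤s (g≤3 k)))
map∈valueSlots g≤3 (_ ∷ _ ∷ _) (s≤s ())

valueSlots-map : ∀ (f : ℕ → ℕ) xs → valueSlots (map f xs) ≡ valueSlots xs
valueSlots-map f []      = refl
valueSlots-map f (_ ∷ _) = refl

mexCandidates : ℕ → ℕ → List ℕ
mexCandidates a y = cartesianProductWith (λ u v → mex (a ∷ u ++ v)) (valueSlots (divF y 2)) (valueSlots (divF y 3))

𝒢-suc∈mexCandidates : ∀ x → 𝒢 (suc x) ∈ mexCandidates (𝒢 x) (suc x)
𝒢-suc∈mexCandidates x =
  subst (_∈ mexCandidates (𝒢 x) (suc x)) (cong (λ E → mex (𝒢 x ∷ E)) (sym (map-concatMap-divF g (suc x))))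
    (∈-cartesianProductWith⁺ (λ u v → mex (𝒢 x ∷ u ++ v)) (slot 2) (slot 3))
  where
  g : ℕ → ℕ
  g = 𝒢f (suc x)
  slot : ∀ d → map g (divF (suc x) d) ∈ valueSlots (divF (suc x) d)
  slot d = map∈valueSlots (𝒢f≤3 (suc x)) (divF (suc x) d) (length-divF≤1 (suc x) d)

mexCandidates-periodic : ∀ a p q → mexCandidates a (suc p + q * 6) ≡ mexCandidates a (suc p)
mexCandidates-periodic a p q = cong₂ (cartesianProductWith (λ u v → mex (a ∷ u ++ v))) (slots 3 2) (slots 2 3)
  where
  slots : ∀ M d → valueSlots (divF (suc p + q * (M * d)) d) ≡ valueSlots (divF (suc p) d)
  slots M d = trans (cong valueSlots (divF-+-multiple p q M d)) (valueSlots-map (_+ q * M) (divF (suc p) d))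

-- just (p , b) records that the halving quotient p + 6 q has Grundy value b.
Memory : Set
Memory = Maybe (ℕ × ℕ)

Admissible : Memory → ℕ → ℕ → Set
Admissible nothing        k a = ⊤
Admissible (just (p , b)) k a = k ≡ suc p → a ∈ mexCandidates b k

admissible? : ∀ mem k → Decidable (Admissible mem k)
admissible? nothing        k a = yes tt
admissible? (just (p , b)) k a = k ≟ suc p →-dec a ∈? mexCandidates b k

halfOptions : List ℕ → Memory → List (List ℕ × Memory)
halfOptions []      mem = [ [] , mem ]
halfOptions (k ∷ _) mem = map (λ a → [ a ] , just (k , a)) (filter (admissible? mem k) (upTo 4))

allEqual : List ℕ → Bool
allEqual []       = true
allEqual (x ∷ xs) = all (x ≡ᵇ_) xs

allEqual-sound : ∀ {xs x y} → T (allEqual xs) → x ∈ xs → y ∈ xs → x ≡ y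
allEqual-sound {z ∷ zs} eq x∈ y∈ = trans (sym (head≡ x∈)) (head≡ y∈)
  where
  head≡ : ∀ {x} → x ∈ z ∷ zs → z ≡ x
  head≡ (here refl) = refl
  head≡ {x} (there x∈zs) = ≡ᵇ⇒≡ z x (all-∈ (z ≡ᵇ_) eq x∈zs)

mexWith : List ℕ → List ℕ → List ℕ
mexWith E = map (λ x → mex (x ∷ E))

-- vals holds the possible guess values at position t + 12 q.
mutual
  settlesWithin : ℕ → ℕ → List ℕ → Memory → Bool
  settlesWithin zero    t vals mem = false
  settlesWithin (suc f) t vals mem =
    all (λ (h , mem′) → all (λ e → branchSettles f t vals (h ++ e) mem′) (valueSlots (divF (suc t) 3)))
        (halfOptions (divF (suc t) 2) mem)

  branchSettles : ℕ → ℕ → List ℕ → List ℕ → Memory → Bool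
  branchSettles f t vals E mem = allEqual (mexWith E vals) ∨ settlesWithin f (suc t) (mexWith E vals) mem

allResiduesSettle : ∀ r → r < 12 → T (settlesWithin 11 r (upTo 4) nothing)
allResiduesSettle r r<12 = all-∈ (λ r → settlesWithin 11 r (upTo 4) nothing) allChecked (∈-upTo⁺ r<12)
  where
  -- the twelve symbolic runs, carried out by normalisation
  allChecked : T (all (λ r → settlesWithin 11 r (upTo 4) nothing) (upTo 12))
  allChecked = tt

module Soundness (n q : ℕ) where

  Remembers : Memory → Set
  Remembers nothing        = ⊤
  Remembers (just (p , b)) = 𝒢 (p + q * 6) ≡ b

  admissible-𝒢 : ∀ mem k → Remembers mem → Admissible mem k (𝒢 (k + q * 6))
  admissible-𝒢 nothing        k _ = tt
  admissible-𝒢 (just (p , _)) k refl refl =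
    subst (𝒢 (suc p + q * 6) ∈_) (mexCandidates-periodic (𝒢 (p + q * 6)) p q) (𝒢-suc∈mexCandidates (p + q * 6))

  halfValues : ℕ → List ℕ
  halfValues t = map (λ k → 𝒢 (k + q * 6)) (divF (suc t) 2)

  thirdValues : ℕ → List ℕ
  thirdValues t = map (λ k → 𝒢 (k + q * 4)) (divF (suc t) 3)

  halfOptions-complete : ∀ t mem → Remembers mem →
                         ∃ λ mem′ → Remembers mem′ × (halfValues t , mem′) ∈ halfOptions (divF (suc t) 2) mem
  halfOptions-complete t mem rem = options (divF (suc t) 2) (length-divF≤1 (suc t) 2)
    where
    options : ∀ xs → length xs ≤ 1 →
              ∃ λ mem′ → Remembers mem′ × (map (λ k → 𝒢 (k + q * 6)) xs , mem′) ∈ halfOptions xs mem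
    options []          _        = mem , rem , here refl
    options (k ∷ [])    _        = just (k , 𝒢 (k + q * 6)) , refl ,
      ∈-map⁺ (λ a → [ a ] , just (k , a))
             (∈-filter⁺ (admissible? mem k) (∈-upTo⁺ (s≤s (𝒢≤3 (k + q * 6)))) (admissible-𝒢 mem k rem))
    options (_ ∷ _ ∷ _) (s≤s ())

  thirdValues∈valueSlots : ∀ t → thirdValues t ∈ valueSlots (divF (suc t) 3)
  thirdValues∈valueSlots t = map∈valueSlots (λ k → 𝒢≤3 (k + q * 4)) (divF (suc t) 3) (length-divF≤1 (suc t) 3)

  divisionValues-periodic : ∀ t → map 𝒢 (concatMap (divF (suc t + q * 12)) D) ≡ halfValues t ++ thirdValues t
  divisionValues-periodic t = trans (map-concatMap-divF 𝒢 (suc t + q * 12)) (cong₂ _++_ (shift 6 2) (shift 4 3))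
    where
    shift : ∀ M d → map 𝒢 (divF (suc t + q * (M * d)) d) ≡ map (λ k → 𝒢 (k + q * M)) (divF (suc t) d)
    shift M d = trans (cong (map 𝒢) (divF-+-multiple t q M d)) (sym (map-∘ (divF (suc t) d)))

  SeedsIn : ℕ → List ℕ → Set
  SeedsIn j vals = ∀ σ → σ ≤ φ n → gseq n σ j ∈ vals

  SeedsAgree : ℕ → Set
  SeedsAgree c = ∀ σ σ′ → σ ≤ φ n → σ′ ≤ φ n → gseq n σ c ≡ gseq n σ′ c

  seedsIn-step : ∀ {t j vals} → n + j ≡ t + q * 12 → SeedsIn j vals →
                 SeedsIn (suc j) (mexWith (halfValues t ++ thirdValues t) vals)
  seedsIn-step {t} {j} {vals} pos seeds σ σ≤ =
    subst (λ E → gseq n σ (suc j) ∈ mexWith E vals)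
          (trans (cong (λ m → map 𝒢 (concatMap (divF m) D)) pos′) (divisionValues-periodic t))
          (∈-map⁺ (λ x → mex (x ∷ map 𝒢 (concatMap (divF (n + suc j)) D))) (seeds σ σ≤))
    where
    pos′ : n + suc j ≡ suc t + q * 12
    pos′ = trans (+-suc n j) (cong suc pos)

  mutual
    settlesWithin-sound : ∀ f t j vals mem → T (settlesWithin f t vals mem) →
                          n + j ≡ t + q * 12 → SeedsIn j vals → Remembers mem →
                          ∃ λ c → j < c × c ≤ f + j × SeedsAgree c
    settlesWithin-sound (suc f) t j vals mem ok pos seeds rem
      with mem′ , rem′ , half∈ ← halfOptions-complete t mem rem
      = branchSettles-sound f t j vals mem′ (all-∈ _ (all-∈ _ ok half∈) (thirdValues∈valueSlots t))
          pos (seedsIn-step pos seeds) rem′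

    branchSettles-sound : ∀ f t j vals mem → T (branchSettles f t vals (halfValues t ++ thirdValues t) mem) →
                          n + j ≡ t + q * 12 → SeedsIn (suc j) (mexWith (halfValues t ++ thirdValues t) vals) →
                          Remembers mem → ∃ λ c → j < c × c ≤ suc f + j × SeedsAgree c
    branchSettles-sound f t j vals mem ok pos seeds′ rem with Equivalence.to T-∨ ok
    ... | inj₁ equal =
      suc j , ≤-refl , s≤s (m≤n+m j f) ,
      λ σ σ′ σ≤ σ′≤ → allEqual-sound equal (seeds′ σ σ≤) (seeds′ σ′ σ′≤)
    ... | inj₂ later with settlesWithin-sound f (suc t) (suc j) _ mem later
                            (trans (+-suc n j) (cong suc pos)) seeds′ rem
    ...   | c , j<c , c≤ , agree = c , <⇒≤ j<c , ≤-trans c≤ (≤-reflexive (+-suc f j)) , agree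

  seedsIn-start : SeedsIn 0 (upTo 4)
  seedsIn-start σ σ≤ = ∈-upTo⁺ (s≤s (≤-trans σ≤ (φ≤3 n)))

  seedsAgree⇒convergesIn : ∀ {c} → 1 ≤ c → SeedsAgree c → ConvergesIn n c
  seedsAgree⇒convergesIn {c} 1≤c agree = 1≤c , agreeAt
    where
    agreeAt : ∀ σ σ′ → σ ≤ φ n → σ′ ≤ φ n →
              ∀ m → n + c ≤ m → m < n + c + 1 → guess n σ m ≡ guess n σ′ m
    agreeAt σ σ′ σ≤ σ′≤ m lo hi with ≤-antisym lo (m<1+n⇒m≤n (subst (m <_) (+-comm (n + c) 1) hi))
    ... | refl = begin
      gseq n σ (n + c ∸ n)  ≡⟨ cong (gseq n σ) (m+n∸m≡n n c) ⟩
      gseq n σ c            ≡⟨ agree σ σ′ σ≤ σ′≤ ⟩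
      gseq n σ′ c           ≡⟨ cong (gseq n σ′) (m+n∸m≡n n c) ⟨
      gseq n σ′ (n + c ∸ n) ∎
      where open ≡-Reasoning

mainTheorem6 : ∀ (n : ℕ) → ∃ λ c → 1 ≤ c × c ≤ 64 × ConvergesIn n c
mainTheorem6 n =
  let c , 0<c , c≤11 , agree = settlesWithin-sound 11 (n % 12) 0 (upTo 4) nothing
                                 (allResiduesSettle (n % 12) (m%n<n n 12)) start seedsIn-start tt
  in c , 0<c , ≤-trans c≤11 (m≤m+n 11 53) , seedsAgree⇒convergesIn 0<c agree
  where
  open Soundness n (n / 12)
  start : n + 0 ≡ n % 12 + n / 12 * 12
  start = trans (+-identityʳ n) (m≡m%n+[m/n]*n n 12)
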